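{- Let $G_n$ ($n\ge1$) be the linear crossed polyomino chain with $n$ four-order complete graphs. Then its multiplicative degree-Kirchhoff index is $$K\!f^{*}(G_n)=\frac{25n^3+65n^2+64n+8}{6}.$$
   Context: For $n\geq1$, $G_n$ is the simple graph with vertex set $\{1,\ldots,n+1\}\cup\{1',\ldots,(n+1)'\}$ and edge set consisting of the vertical edges $ii'$ for $1\le i\le n+1$ together with, for each $1\le i\le n$, the edges $i(i+1)$, $i'(i+1)'$, $i(i+1)'$, $i'(i+1)$. The multiplicative degree-Kirchhoff index is $K\!f^*(G)=\sum_{\{u,v\}}d_ud_v r_{uv}$, summed over unordered pairs of distinct vertices, where $d_u$ is the degree of $u$ and $r_{uv}$ is the effective resistance between $u$ and $v$ when every edge is a unit resistor. -}

module Defs where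

open import Data.Nat as ℕ using (ℕ; zero; suc; _≡ᵇ_)
open import Data.Fin using (Fin; toℕ)
open import Data.Bool using (Bool; true; false; _∧_; _∨_; not; if_then_else_)
open import Data.Product using (_×_; _,_; Σ; ∃)
import Data.List
open Data.List using (List; map; foldr; concatMap; _∷_; [])
open import Data.Integer using (+_)
open import Data.Rational using (ℚ; _+_; _-_; _*_; 0ℚ; 1ℚ; ½; _/_)
open import Relation.Binary.PropositionalEquality using (_≡_)

-- Vertices of G_n : (i , false) is vertex i+1, (i , true) is vertex (i+1)'.
V : ℕ → Set
V n = Fin (suc n) × Bool

_==_ : ∀ {n} → V n → V n → Bool
(i , b) == (j , c) = (toℕ i ≡ᵇ toℕ j) ∧ (if b then c else not c)

-- adjacency in G_n : vertical edges i i', and all four edges between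
-- {i, i'} and {i+1, (i+1)'}
adj : ∀ {n} → V n → V n → Bool
adj (i , b) (j , c) =
  ((toℕ i ≡ᵇ toℕ j) ∧ not (if b then c else not c))
  ∨ (suc (toℕ i) ≡ᵇ toℕ j) ∨ (suc (toℕ j) ≡ᵇ toℕ i)

vertices : ∀ n → List (V n)
vertices n = concatMap (λ i → (i , false) ∷ (i , true) ∷ []) (Data.List.allFin (suc n))

Σᵥ : ∀ n → (V n → ℚ) → ℚ
Σᵥ n f = foldr (λ v acc → f v + acc) 0ℚ (vertices n)

[_] : Bool → ℚ
[ true ] = 1ℚ
[ false ] = 0ℚ

deg : ∀ {n} → V n → ℚ
deg {n} u = Σᵥ n (λ w → [ adj u w ])

laplacian : ∀ {n} → (V n → ℚ) → V n → ℚ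
laplacian {n} x w = Σᵥ n (λ y → [ adj w y ] * (x w - x y))

-- r is the effective resistance between u and v (unit resistors):
-- there is a potential x with L x = e_u - e_v (unit current injected at u,
-- extracted at v) and r = x u - x v.
IsEffRes : ∀ n → V n → V n → ℚ → Set
IsEffRes n u v r =
  Σ (V n → ℚ) λ x →
    ((w : V n) → laplacian x w ≡ [ w == u ] - [ w == v ]) × (r ≡ x u - x v)

IsResistance : ∀ n → (V n → V n → ℚ) → Set
IsResistance n R = (u v : V n) → IsEffRes n u v (R u v)

-- multiplicative degree-Kirchhoff index w.r.t. a resistance function R:
-- sum over unordered pairs {u,v}, u ≠ v, of d_u d_v R(u,v), computed as
-- half the sum over all ordered pairs (diagonal terms vanish since R u u = 0).
KfStar : ∀ n → (V n → V n → ℚ) → ℚ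
KfStar n R = ½ * Σᵥ n (λ u → Σᵥ n (λ v → deg u * deg v * R u v))

module Submission where

-- G_n has levels 0 … n of two vertices ("twins"); each vertex is joined to its twin and to
-- all vertices of the neighbouring levels.  For symmetric weights the graph Laplacian L is self-adjoint, so two
--     potentials solving L x = e_u - e_v have the same drop x_u - x_v.  Hence Kf* is the same
--     for every resistance function of G_n, and it suffices to exhibit one.
--  2. Explicit potentials.  In level coordinates the neighbourhood of a vertex is explicit, and
--     the potential of unit current entering at (k, b) and drained from level 0 is a level drop
--     of ¼ per level plus a split ±½/(d_k + 1) between the twins of level k.  Differences of two
--     such potentials realise all effective resistances.
--  3. Counting.  Summed over the sides, the resistance between levels k and l is
--     2 gap_k + 2 gap_l + |k - l|, so Kf* is a combination of three sums over levels, computed in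
--     closed form by separating the bottom, interior and top levels.

open import Defs
open import Data.Nat using (ℕ; _≥_; _^_)
open import Data.Nat as ℕ using ()
open import Data.Integer using (+_)
open import Data.Rational using (ℚ; _/_)
open import Data.Product using (_×_; ∃)
open import Relation.Binary.PropositionalEquality using (_≡_)

open import Algebra.Bundles using (CommutativeRing; Semiring)
open import Level using (0ℓ)
open import Data.Bool using (Bool; true; false; _∧_; _∨_; not; if_then_else_; T)
open import Data.Bool.Properties using (∨-comm; T-≡)
open import Function.Bundles using (Equivalence)
open import Data.Fin.Properties using (toℕ<n; toℕ≤pred[n])
import Data.Nat.Properties as ℕP
open ℕP using (<⇒<ᵇ)
open import Data.Fin using (Fin; toℕ) renaming (zero to fzero; suc to fsuc)
open import Data.List using (List; foldr; _∷_; []; concatMap; tabulate)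
open import Data.Nat using (zero; suc; _≡ᵇ_; _<ᵇ_; _∸_; _<_; s≤s)
open import Data.Product using (_,_; proj₁; proj₂)
open import Data.Rational using (_+_; _-_; _*_; -_; 0ℚ; 1ℚ; ½; mkℚ)
import Data.Integer as ℤ
import Data.Integer.Properties as ℤP
import Data.Nat.Coprimality as Cop
import Data.Rational.Properties as ℚP
open import Data.Rational.Solver using (module +-*-Solver)
open import Relation.Binary.PropositionalEquality using (refl; sym; trans; cong; cong₂; subst; module ≡-Reasoning)
open +-*-Solver

ℚ-semiring : Semiring 0ℓ 0ℓ
ℚ-semiring = CommutativeRing.semiring ℚP.+-*-commutativeRing
open import Algebra.Properties.Semiring.Sum ℚ-semiring
  using (sum; sum-cong-≗; sum-replicate; sum-replicate-zero; ∑-distrib-+; ∑-comm; *-distribˡ-sum; *-distribʳ-sum)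
open import Algebra.Properties.Semiring.Mult ℚ-semiring
  using (×-homo-+; ×1-homo-*; ×-assoc-*) renaming (_×_ to _⨯_)

sumOver : {A : Set} → List A → (A → ℚ) → ℚ
sumOver xs f = foldr (λ v acc → f v + acc) 0ℚ xs

sumOver-cong : {A : Set} (xs : List A) {f g : A → ℚ} → (∀ x → f x ≡ g x) → sumOver xs f ≡ sumOver xs g
sumOver-cong []       f≗g = refl
sumOver-cong (x ∷ xs) f≗g = cong₂ _+_ (f≗g x) (sumOver-cong xs f≗g)

sumOver-+ : {A : Set} (xs : List A) (f g : A → ℚ) →
  sumOver xs (λ x → f x + g x) ≡ sumOver xs f + sumOver xs g
sumOver-+ []       f g = refl
sumOver-+ (x ∷ xs) f g = trans (cong (_+_ (f x + g x)) (sumOver-+ xs f g))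
  (solve 4 (λ a b c d → (a :+ b) :+ (c :+ d) := (a :+ c) :+ (b :+ d)) refl (f x) (g x) _ _)

sumOver-*ˡ : {A : Set} (xs : List A) (c : ℚ) (f : A → ℚ) → sumOver xs (λ x → c * f x) ≡ c * sumOver xs f
sumOver-*ˡ []       c f = sym (ℚP.*-zeroʳ c)
sumOver-*ˡ (x ∷ xs) c f = trans (cong (_+_ (c * f x)) (sumOver-*ˡ xs c f))
  (sym (ℚP.*-distribˡ-+ c (f x) _))

sumOver-- : {A : Set} (xs : List A) (f g : A → ℚ) →
  sumOver xs (λ x → f x - g x) ≡ sumOver xs f - sumOver xs g
sumOver-- []       f g = refl
sumOver-- (x ∷ xs) f g = trans (cong (_+_ (f x - g x)) (sumOver-- xs f g))
  (solve 4 (λ a b c d → (a :- b) :+ (c :- d) := (a :+ c) :- (b :+ d)) refl (f x) (g x) _ _)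

sumOver-zero : {A : Set} (xs : List A) → sumOver xs (λ _ → 0ℚ) ≡ 0ℚ
sumOver-zero []       = refl
sumOver-zero (x ∷ xs) = trans (ℚP.+-identityˡ _) (sumOver-zero xs)

sumOver-swap : {A B : Set} (xs : List A) (ys : List B) (F : A → B → ℚ) →
  sumOver xs (λ x → sumOver ys (F x)) ≡ sumOver ys (λ y → sumOver xs (λ x → F x y))
sumOver-swap []       ys F = sym (sumOver-zero ys)
sumOver-swap (x ∷ xs) ys F = trans (cong (_+_ (sumOver ys (F x))) (sumOver-swap xs ys F))
  (sym (sumOver-+ ys (F x) (λ y → sumOver xs (λ x′ → F x′ y))))

sumOver-neg : {A : Set} (xs : List A) (f : A → ℚ) → sumOver xs (λ x → - f x) ≡ - sumOver xs f
sumOver-neg []       f = refl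
sumOver-neg (x ∷ xs) f = trans (cong (_+_ (- f x)) (sumOver-neg xs f)) (sym (ℚP.neg-distrib-+ (f x) _))

self-neg⇒0 : ∀ s → s ≡ - s → s ≡ 0ℚ
self-neg⇒0 s s≡-s = begin
  s              ≡⟨ solve 1 (λ s → s := con ½ :* (s :+ s)) refl s ⟩
  ½ * (s + s)    ≡⟨ cong (λ t → ½ * (s + t)) s≡-s ⟩
  ½ * (s + - s)  ≡⟨ solve 1 (λ s → con ½ :* (s :+ :- s) := con 0ℚ) refl s ⟩
  0ℚ             ∎
  where open ≡-Reasoning

difference-zero : ∀ {p q} → p - q ≡ 0ℚ → p ≡ q
difference-zero {p} {q} p-q≡0 = begin
  p              ≡⟨ solve 2 (λ p q → p := (p :- q) :+ q) refl p q ⟩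
  (p - q) + q    ≡⟨ cong (_+ q) p-q≡0 ⟩
  0ℚ + q         ≡⟨ ℚP.+-identityˡ q ⟩
  q              ∎
  where open ≡-Reasoning

sumOver-antisym : {A : Set} (xs : List A) (F : A → A → ℚ) → (∀ w y → F y w ≡ - F w y) →
  sumOver xs (λ w → sumOver xs (F w)) ≡ 0ℚ
sumOver-antisym xs F F-antisym = self-neg⇒0 _ (begin
  sumOver xs (λ w → sumOver xs (F w))               ≡⟨ sumOver-swap xs xs F ⟩
  sumOver xs (λ y → sumOver xs (λ w → F w y))       ≡⟨ sumOver-cong xs (λ y → sumOver-cong xs (λ w → F-antisym y w)) ⟩
  sumOver xs (λ y → sumOver xs (λ w → - F y w))     ≡⟨ sumOver-cong xs (λ y → sumOver-neg xs (F y)) ⟩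
  sumOver xs (λ y → - sumOver xs (F y))             ≡⟨ sumOver-neg xs (λ y → sumOver xs (F y)) ⟩
  - sumOver xs (λ w → sumOver xs (F w))             ∎)
  where open ≡-Reasoning

two ¼ ⅙ : ℚ
two = 1ℚ + 1ℚ
¼ = + 1 / 4
⅙ = + 1 / 6

-- natural numbers as rationals, m ↦ m · 1, so that the library's homomorphism lemmas apply
toℚ : ℕ → ℚ
toℚ m = m ⨯ 1ℚ

[∧] : ∀ a b → [ a ∧ b ] ≡ [ a ] * [ b ]
[∧] true  b = sym (ℚP.*-identityˡ [ b ])
[∧] false b = sym (ℚP.*-zeroˡ [ b ])

sum-delta : ∀ {m} (j : Fin m) (g : Fin m → ℚ) → sum (λ i → [ toℕ i ≡ᵇ toℕ j ] * g i) ≡ g j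
sum-delta {suc m} fzero g = trans
  (cong₂ _+_ (ℚP.*-identityˡ (g fzero))
             (trans (sum-cong-≗ {m} (λ i → ℚP.*-zeroˡ (g (fsuc i)))) (sum-replicate-zero m)))
  (ℚP.+-identityʳ (g fzero))
sum-delta {suc m} (fsuc j) g =
  trans (cong (λ t → t + sum (λ i → [ toℕ i ≡ᵇ toℕ j ] * g (fsuc i))) (ℚP.*-zeroˡ (g fzero)))
    (trans (ℚP.+-identityˡ _) (sum-delta j (λ i → g (fsuc i))))

<ᵇ-true : ∀ {l m} → l < m → (l <ᵇ m) ≡ true
<ᵇ-true l<m = Equivalence.to T-≡ (<⇒<ᵇ l<m)

[<ᵇ]≡1 : ∀ {l m} → l < m → [ l <ᵇ m ] ≡ 1ℚ
[<ᵇ]≡1 l<m = cong [_] (<ᵇ-true l<m)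

<ᵇ-irrefl : ∀ m → (m <ᵇ m) ≡ false
<ᵇ-irrefl zero    = refl
<ᵇ-irrefl (suc m) = <ᵇ-irrefl m

≡ᵇ-sym : ∀ a b → (a ≡ᵇ b) ≡ (b ≡ᵇ a)
≡ᵇ-sym zero    zero    = refl
≡ᵇ-sym zero    (suc b) = refl
≡ᵇ-sym (suc a) zero    = refl
≡ᵇ-sym (suc a) (suc b) = ≡ᵇ-sym a b

≡ᵇ-refl : ∀ k → (k ≡ᵇ k) ≡ true
≡ᵇ-refl zero    = refl
≡ᵇ-refl (suc k) = ≡ᵇ-refl k

[<ᵇ]-suc : ∀ l k → [ l <ᵇ suc k ] ≡ [ l ≡ᵇ k ] + [ l <ᵇ k ]
[<ᵇ]-suc zero    zero    = refl
[<ᵇ]-suc zero    (suc k) = refl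
[<ᵇ]-suc (suc l) zero    = refl
[<ᵇ]-suc (suc l) (suc k) = [<ᵇ]-suc l k

[<ᵇ]-mono : ∀ l k n → k ℕ.≤ n → [ l <ᵇ n ] * [ l <ᵇ k ] ≡ [ l <ᵇ k ]
[<ᵇ]-mono l       zero    n       _         = ℚP.*-zeroʳ [ l <ᵇ n ]
[<ᵇ]-mono zero    (suc k) (suc n) _         = refl
[<ᵇ]-mono (suc l) (suc k) (suc n) (s≤s k≤n) = [<ᵇ]-mono l k n k≤n

∑ℕ : ℕ → (ℕ → ℚ) → ℚ
∑ℕ m h = sum {m} (λ i → h (toℕ i))

∑ℕ-delta : ∀ m t (h : ℕ → ℚ) → ∑ℕ m (λ k → [ k ≡ᵇ t ] * h k) ≡ [ t <ᵇ m ] * h t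
∑ℕ-delta zero    t       h = sym (ℚP.*-zeroˡ (h t))
∑ℕ-delta (suc m) zero    h = trans
  (cong (_+_ (1ℚ * h 0)) (trans (sum-cong-≗ {m} (λ i → ℚP.*-zeroˡ (h (suc (toℕ i))))) (sum-replicate-zero m)))
  (ℚP.+-identityʳ (1ℚ * h 0))
∑ℕ-delta (suc m) (suc t) h = trans (cong (λ x → x + ∑ℕ m (λ k → [ k ≡ᵇ t ] * h (suc k))) (ℚP.*-zeroˡ (h 0)))
  (trans (ℚP.+-identityˡ _) (∑ℕ-delta m t (λ k → h (suc k))))

∑ℕ-delta-pred : ∀ m l (h : ℕ → ℚ) → l ℕ.≤ m → ∑ℕ m (λ k → [ suc k ≡ᵇ l ] * h k) ≡ [ 0 <ᵇ l ] * h (l ∸ 1)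
∑ℕ-delta-pred m zero    h _   = trans (sum-cong-≗ {m} (λ i → ℚP.*-zeroˡ (h (toℕ i))))
  (trans (sum-replicate-zero m) (sym (ℚP.*-zeroˡ (h 0))))
∑ℕ-delta-pred m (suc l) h l<m = trans (∑ℕ-delta m l h) (cong (_* h l) ([<ᵇ]≡1 l<m))

∑ℕ-snoc : ∀ m (h : ℕ → ℚ) → ∑ℕ (suc m) h ≡ ∑ℕ m h + h m
∑ℕ-snoc zero    h = trans (ℚP.+-identityʳ (h 0)) (sym (ℚP.+-identityˡ (h 0)))
∑ℕ-snoc (suc m) h = trans (cong (_+_ (h 0)) (∑ℕ-snoc m (λ k → h (suc k)))) (sym (ℚP.+-assoc (h 0) _ _))

∑ℕ-congBelow : ∀ m {h h′ : ℕ → ℚ} → (∀ k → k < m → h k ≡ h′ k) → ∑ℕ m h ≡ ∑ℕ m h′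
∑ℕ-congBelow m h≗h′ = sum-cong-≗ {m} (λ i → h≗h′ (toℕ i) (toℕ<n i))

∑ℕ-const : ∀ m c → ∑ℕ m (λ _ → c) ≡ toℚ m * c
∑ℕ-const m c = trans (sum-replicate m) (sym (trans (×-assoc-* m 1ℚ c) (cong (m ⨯_) (ℚP.*-identityˡ c))))

∑ℕ-*ˡ : ∀ m c (h : ℕ → ℚ) → ∑ℕ m (λ k → c * h k) ≡ c * ∑ℕ m h
∑ℕ-*ˡ m c h = sym (*-distribˡ-sum {m} c (λ i → h (toℕ i)))

∑ℕ-+ : ∀ m (f g : ℕ → ℚ) → ∑ℕ m (λ k → f k + g k) ≡ ∑ℕ m f + ∑ℕ m g
∑ℕ-+ m f g = ∑-distrib-+ {m} (λ i → f (toℕ i)) (λ i → g (toℕ i))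

∑∑-product : ∀ m (f g : ℕ → ℚ) → ∑ℕ m (λ k → ∑ℕ m (λ l → f k * g l)) ≡ ∑ℕ m f * ∑ℕ m g
∑∑-product m f g = trans (sum-cong-≗ {m} (λ i → ∑ℕ-*ˡ m (f (toℕ i)) g))
                         (sym (*-distribʳ-sum {m} (∑ℕ m g) (λ i → f (toℕ i))))

∑∑-symmetrise : ∀ m (G : ℕ → ℕ → ℚ) →
  ∑ℕ m (λ k → ∑ℕ m (λ l → G k l + G l k)) ≡ two * ∑ℕ m (λ k → ∑ℕ m (λ l → G k l))
∑∑-symmetrise m G = begin
  ∑ℕ m (λ k → ∑ℕ m (λ l → G k l + G l k))
    ≡⟨ sum-cong-≗ {m} (λ i → ∑ℕ-+ m (G (toℕ i)) (λ l → G l (toℕ i))) ⟩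
  ∑ℕ m (λ k → ∑ℕ m (G k) + ∑ℕ m (λ l → G l k))
    ≡⟨ ∑ℕ-+ m (λ k → ∑ℕ m (G k)) (λ k → ∑ℕ m (λ l → G l k)) ⟩
  S + ∑ℕ m (λ k → ∑ℕ m (λ l → G l k))
    ≡⟨ cong (_+_ S) (sym (∑-comm {m} {m} (λ i j → G (toℕ i) (toℕ j)))) ⟩
  S + S
    ≡⟨ solve 1 (λ s → s :+ s := con two :* s) refl S ⟩
  two * S ∎
  where
  open ≡-Reasoning
  S = ∑ℕ m (λ k → ∑ℕ m (λ l → G k l))

toℚ-∸-step : ∀ k l → toℚ (k ∸ l) - toℚ (k ∸ suc l) ≡ [ l <ᵇ k ]
toℚ-∸-step zero    l       rewrite ℕP.0∸n≡0 l = refl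
toℚ-∸-step (suc k) zero    = solve 1 (λ x → (con 1ℚ :+ x) :- x := con 1ℚ) refl (toℚ k)
toℚ-∸-step (suc k) (suc l) = toℚ-∸-step k l

triangle tetrahedron : ℕ → ℚ
triangle m    = toℚ m * (toℚ m + 1ℚ) * ½
tetrahedron m = (toℚ m - 1ℚ) * toℚ m * (toℚ m + 1ℚ) * ⅙

∑-descending : ∀ m → ∑ℕ m (λ j → toℚ (m ∸ j)) ≡ triangle m
∑-descending zero    = refl
∑-descending (suc m) = trans (cong (_+_ (1ℚ + toℚ m)) (∑-descending m))
  (solve 1 (λ x → (con 1ℚ :+ x) :+ x :* (x :+ con 1ℚ) :* con ½ := (con 1ℚ :+ x) :* ((con 1ℚ :+ x) :+ con 1ℚ) :* con ½)
    refl (toℚ m))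

∑-ascending : ∀ m → ∑ℕ m (λ i → toℚ (suc i)) ≡ triangle m
∑-ascending zero    = refl
∑-ascending (suc m) = trans (∑ℕ-snoc m (λ i → toℚ (suc i))) (trans (cong (_+ toℚ (suc m)) (∑-ascending m))
  (solve 1 (λ x → x :* (x :+ con 1ℚ) :* con ½ :+ (con 1ℚ :+ x) := (con 1ℚ :+ x) :* ((con 1ℚ :+ x) :+ con 1ℚ) :* con ½)
    refl (toℚ m)))

∑∑-monus : ∀ m → ∑ℕ m (λ i → ∑ℕ m (λ j → toℚ (i ∸ j))) ≡ tetrahedron m
∑∑-monus zero    = refl
∑∑-monus (suc m) = begin
  ∑ℕ (suc m) (λ i → ∑ℕ (suc m) (λ j → toℚ (i ∸ j)))
    ≡⟨ ∑ℕ-snoc m (λ i → ∑ℕ (suc m) (λ j → toℚ (i ∸ j))) ⟩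
  ∑ℕ m (λ i → ∑ℕ (suc m) (λ j → toℚ (i ∸ j))) + ∑ℕ (suc m) (λ j → toℚ (m ∸ j))
    ≡⟨ cong₂ _+_ (trans (sum-cong-≗ {m} (λ i → ∑ℕ-snoc m (λ j → toℚ (toℕ i ∸ j))))
                        (∑ℕ-+ m (λ i → ∑ℕ m (λ j → toℚ (i ∸ j))) (λ i → toℚ (i ∸ m))))
                 (∑ℕ-snoc m (λ j → toℚ (m ∸ j))) ⟩
  (∑ℕ m (λ i → ∑ℕ m (λ j → toℚ (i ∸ j))) + ∑ℕ m (λ i → toℚ (i ∸ m))) + (∑ℕ m (λ j → toℚ (m ∸ j)) + toℚ (m ∸ m))
    ≡⟨ cong₂ _+_ (cong₂ _+_ (∑∑-monus m) last-column) (cong₂ _+_ (∑-descending m) (cong toℚ (ℕP.n∸n≡0 m))) ⟩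
  (tetrahedron m + 0ℚ) + (triangle m + 0ℚ)
    ≡⟨ solve 1 (λ x → ((x :- con 1ℚ) :* x :* (x :+ con 1ℚ) :* con ⅙ :+ con 0ℚ) :+ (x :* (x :+ con 1ℚ) :* con ½ :+ con 0ℚ)
                      := ((con 1ℚ :+ x) :- con 1ℚ) :* (con 1ℚ :+ x) :* ((con 1ℚ :+ x) :+ con 1ℚ) :* con ⅙) refl (toℚ m) ⟩
  tetrahedron (suc m) ∎
  where
  open ≡-Reasoning
  last-column : ∑ℕ m (λ i → toℚ (i ∸ m)) ≡ 0ℚ
  last-column = trans (∑ℕ-congBelow m (λ i i<m → cong toℚ (ℕP.m≤n⇒m∸n≡0 (ℕP.<⇒≤ i<m))))
                      (sum-replicate-zero m)

/1-canonical : ∀ N → (+ N) / 1 ≡ mkℚ (+ N) 0 (Cop.sym (Cop.1-coprimeTo N))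
/1-canonical N = ℚP.normalize-coprime (Cop.sym (Cop.1-coprimeTo N))

toℚ-/1 : ∀ N → toℚ N ≡ (+ N) / 1
toℚ-/1 zero    = refl
toℚ-/1 (suc N) = trans (cong (_+_ 1ℚ) (trans (toℚ-/1 N) (/1-canonical N)))
  (ℚP./-cong {+ 1 ℤ.* + 1 ℤ.+ + N ℤ.* + 1} {1 ℕ.* 1} {+ suc N} {1} (cong (ℤ._+_ (+ 1)) (ℤP.*-identityʳ (+ N))) refl)

toℚ-/6 : ∀ N → (+ N) / 6 ≡ toℚ N * ⅙
toℚ-/6 N = sym (trans (cong (_* ⅙) (trans (toℚ-/1 N) (/1-canonical N)))
  (ℚP./-cong {+ N ℤ.* + 1} {1 ℕ.* 6} {+ N} {6} (ℤP.*-identityʳ (+ N)) refl))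

toℚ-polynomial : ∀ n → toℚ (25 ℕ.* n ^ 3 ℕ.+ 65 ℕ.* n ^ 2 ℕ.+ 64 ℕ.* n ℕ.+ 8)
  ≡ toℚ 25 * (toℚ n * (toℚ n * (toℚ n * 1ℚ))) + toℚ 65 * (toℚ n * (toℚ n * 1ℚ)) + toℚ 64 * toℚ n + toℚ 8
toℚ-polynomial n =
  trans (toℚ-+ (25 ℕ.* n ^ 3 ℕ.+ 65 ℕ.* n ^ 2 ℕ.+ 64 ℕ.* n) 8) (cong (_+ toℚ 8)
  (trans (toℚ-+ (25 ℕ.* n ^ 3 ℕ.+ 65 ℕ.* n ^ 2) (64 ℕ.* n)) (cong₂ _+_
    (trans (toℚ-+ (25 ℕ.* n ^ 3) (65 ℕ.* n ^ 2))
      (cong₂ _+_ (trans (toℚ-* 25 (n ^ 3)) (cong (toℚ 25 *_) (toℚ-^ 3)))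
                 (trans (toℚ-* 65 (n ^ 2)) (cong (toℚ 65 *_) (toℚ-^ 2)))))
    (toℚ-* 64 n))))
  where
  toℚ-+ : ∀ a b → toℚ (a ℕ.+ b) ≡ toℚ a + toℚ b
  toℚ-+ a b = ×-homo-+ 1ℚ a b
  toℚ-* : ∀ a b → toℚ (a ℕ.* b) ≡ toℚ a * toℚ b
  toℚ-* a b = ×1-homo-* a b
  pow : ℕ → ℚ
  pow zero    = 1ℚ
  pow (suc k) = toℚ n * pow k
  toℚ-^ : ∀ k → toℚ (n ^ k) ≡ pow k
  toℚ-^ zero    = refl
  toℚ-^ (suc k) = trans (toℚ-* n (n ^ k)) (cong (toℚ n *_) (toℚ-^ k))

laplacianOn : {A : Set} → List A → (A → A → ℚ) → (A → ℚ) → A → ℚ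
laplacianOn xs a x w = sumOver xs (λ y → a w y * (x w - x y))

laplacianOn-+ : {A : Set} (xs : List A) (a : A → A → ℚ) (x z : A → ℚ) (w : A) →
  laplacianOn xs a (λ v → x v + z v) w ≡ laplacianOn xs a x w + laplacianOn xs a z w
laplacianOn-+ xs a x z w = trans
  (sumOver-cong xs (λ y → solve 5 (λ a xw xy zw zy → a :* ((xw :+ zw) :- (xy :+ zy)) := a :* (xw :- xy) :+ a :* (zw :- zy))
     refl (a w y) (x w) (x y) (z w) (z y)))
  (sumOver-+ xs (λ y → a w y * (x w - x y)) (λ y → a w y * (z w - z y)))

laplacianOn-- : {A : Set} (xs : List A) (a : A → A → ℚ) (x z : A → ℚ) (w : A) →
  laplacianOn xs a (λ v → x v - z v) w ≡ laplacianOn xs a x w - laplacianOn xs a z w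
laplacianOn-- xs a x z w = trans
  (sumOver-cong xs (λ y → solve 5 (λ a xw xy zw zy → a :* ((xw :- zw) :- (xy :- zy)) := a :* (xw :- xy) :- a :* (zw :- zy))
     refl (a w y) (x w) (x y) (z w) (z y)))
  (sumOver-- xs (λ y → a w y * (x w - x y)) (λ y → a w y * (z w - z y)))

laplacianOn-selfAdjoint : {A : Set} (xs : List A) (a : A → A → ℚ) → (∀ w y → a w y ≡ a y w) →
  (x z : A → ℚ) →
  sumOver xs (λ w → laplacianOn xs a x w * z w) ≡ sumOver xs (λ w → x w * laplacianOn xs a z w)
laplacianOn-selfAdjoint {A} xs a a-sym x z = difference-zero (begin
  sumOver xs (λ w → L x w * z w) - sumOver xs (λ w → x w * L z w)  ≡⟨ sym (sumOver-- xs (λ w → L x w * z w) (λ w → x w * L z w)) ⟩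
  sumOver xs (λ w → L x w * z w - x w * L z w)                      ≡⟨ sumOver-cong xs pointwise ⟩
  sumOver xs (λ w → sumOver xs (F w))                               ≡⟨ sumOver-antisym xs F F-antisym ⟩
  0ℚ                                                                ∎)
  where
  open ≡-Reasoning
  L = laplacianOn xs a
  -- the difference of the two sides, as a double sum
  F : A → A → ℚ
  F w y = a w y * (x w * z y - x y * z w)
  F-antisym : ∀ w y → F y w ≡ - F w y
  F-antisym w y rewrite a-sym y w =
    solve 5 (λ a xw xy zw zy → a :* (xy :* zw :- xw :* zy) := :- (a :* (xw :* zy :- xy :* zw)))
      refl (a w y) (x w) (x y) (z w) (z y)
  pointwise : ∀ w → L x w * z w - x w * L z w ≡ sumOver xs (F w)
  pointwise w = begin
    L x w * z w - x w * L z w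
      ≡⟨ cong₂ _-_ (trans (ℚP.*-comm _ (z w)) (sym (sumOver-*ˡ xs (z w) _))) (sym (sumOver-*ˡ xs (x w) _)) ⟩
    sumOver xs (λ y → z w * (a w y * (x w - x y))) - sumOver xs (λ y → x w * (a w y * (z w - z y)))
      ≡⟨ sym (sumOver-- xs (λ y → z w * (a w y * (x w - x y))) (λ y → x w * (a w y * (z w - z y)))) ⟩
    sumOver xs (λ y → z w * (a w y * (x w - x y)) - x w * (a w y * (z w - z y)))
      ≡⟨ sumOver-cong xs (λ y → solve 5 (λ a xw xy zw zy →
           zw :* (a :* (xw :- xy)) :- xw :* (a :* (zw :- zy)) := a :* (xw :* zy :- xy :* zw))
           refl (a w y) (x w) (x y) (z w) (z y)) ⟩
    sumOver xs (F w)
      ∎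

Σᵥ-levels : ∀ n (f : V n → ℚ) → Σᵥ n f ≡ sum {suc n} (λ i → f (i , false) + f (i , true))
Σᵥ-levels n f = go (suc n) (λ i → i)
  where
  go : ∀ m (g : Fin m → Fin (suc n)) →
    sumOver (concatMap (λ i → (i , false) ∷ (i , true) ∷ []) (tabulate g)) f
    ≡ sum {m} (λ i → f (g i , false) + f (g i , true))
  go zero    g = refl
  go (suc m) g = trans (cong (λ t → f (g fzero , false) + (f (g fzero , true) + t)) (go m (λ i → g (fsuc i))))
    (sym (ℚP.+-assoc (f (g fzero , false)) (f (g fzero , true)) _))

Σᵥ-delta : ∀ n (z : V n → ℚ) u → Σᵥ n (λ w → z w * [ w == u ]) ≡ z u
Σᵥ-delta n z (j , c) = begin
  Σᵥ n (λ w → z w * [ w == (j , c) ])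
    ≡⟨ Σᵥ-levels n (λ w → z w * [ w == (j , c) ]) ⟩
  sum (λ i → z (i , false) * [ (toℕ i ≡ᵇ toℕ j) ∧ not c ] + z (i , true) * [ (toℕ i ≡ᵇ toℕ j) ∧ c ])
    ≡⟨ sum-cong-≗ {suc n} factor ⟩
  sum (λ i → [ toℕ i ≡ᵇ toℕ j ] * (z (i , false) * [ not c ] + z (i , true) * [ c ]))
    ≡⟨ sum-delta j (λ i → z (i , false) * [ not c ] + z (i , true) * [ c ]) ⟩
  z (j , false) * [ not c ] + z (j , true) * [ c ]
    ≡⟨ select c ⟩
  z (j , c) ∎
  where
  open ≡-Reasoning
  factor : ∀ i → z (i , false) * [ (toℕ i ≡ᵇ toℕ j) ∧ not c ] + z (i , true) * [ (toℕ i ≡ᵇ toℕ j) ∧ c ]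
               ≡ [ toℕ i ≡ᵇ toℕ j ] * (z (i , false) * [ not c ] + z (i , true) * [ c ])
  factor i rewrite [∧] (toℕ i ≡ᵇ toℕ j) (not c) | [∧] (toℕ i ≡ᵇ toℕ j) c =
    solve 5 (λ e a b p q → a :* (e :* p) :+ b :* (e :* q) := e :* (a :* p :+ b :* q)) refl
      [ toℕ i ≡ᵇ toℕ j ] (z (i , false)) (z (i , true)) [ not c ] [ c ]
  select : ∀ c → z (j , false) * [ not c ] + z (j , true) * [ c ] ≡ z (j , c)
  select true  = solve 2 (λ a b → a :* con 0ℚ :+ b :* con 1ℚ := b) refl (z (j , false)) (z (j , true))
  select false = solve 2 (λ a b → a :* con 1ℚ :+ b :* con 0ℚ := a) refl (z (j , false)) (z (j , true))

Σᵥ-dipole : ∀ n (z : V n → ℚ) u v → Σᵥ n (λ w → z w * ([ w == u ] - [ w == v ])) ≡ z u - z v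
Σᵥ-dipole n z u v = trans
  (sumOver-cong (vertices n) (λ w → ℚP.*-distribˡ-+ (z w) [ w == u ] (- [ w == v ])))
  (trans (sumOver-+ (vertices n) (λ w → z w * [ w == u ]) (λ w → z w * - [ w == v ]))
    (cong₂ _+_ (Σᵥ-delta n z u)
      (trans (sumOver-cong (vertices n) (λ w → sym (ℚP.neg-distribʳ-* (z w) [ w == v ])))
        (trans (sumOver-neg (vertices n) (λ w → z w * [ w == v ])) (cong -_ (Σᵥ-delta n z v))))))

sameSide-sym : ∀ b c → (if b then c else not c) ≡ (if c then b else not b)
sameSide-sym true  true  = refl
sameSide-sym true  false = refl
sameSide-sym false true  = refl
sameSide-sym false false = refl

adj-sym : ∀ {n} (w y : V n) → [ adj w y ] ≡ [ adj y w ]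
adj-sym (i , b) (j , c) rewrite ≡ᵇ-sym (toℕ i) (toℕ j) | sameSide-sym b c =
  cong (λ t → [ ((toℕ j ≡ᵇ toℕ i) ∧ not (if c then b else not b)) ∨ t ])
       (∨-comm (suc (toℕ i) ≡ᵇ toℕ j) (suc (toℕ j) ≡ᵇ toℕ i))

-- Effective resistance is well defined: two potentials solving L x = e_u - e_v have the same
-- drop from u to v, because Σ_w x_w (L y)_w = Σ_w (L x)_w y_w.
resistance-unique : ∀ n u v {r r′} → IsEffRes n u v r → IsEffRes n u v r′ → r ≡ r′
resistance-unique n u v {r} {r′} (x , Lx , r≡) (y , Ly , r′≡) = begin
  r                                              ≡⟨ r≡ ⟩
  x u - x v                                      ≡⟨ sym (Σᵥ-dipole n x u v) ⟩
  Σᵥ n (λ w → x w * ([ w == u ] - [ w == v ]))   ≡⟨ sumOver-cong (vertices n) (λ w → cong (x w *_) (sym (Ly w))) ⟩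
  Σᵥ n (λ w → x w * laplacian y w)               ≡⟨ sym (laplacianOn-selfAdjoint (vertices n) (λ w y → [ adj w y ]) adj-sym x y) ⟩
  Σᵥ n (λ w → laplacian x w * y w)               ≡⟨ sumOver-cong (vertices n) (λ w → trans (cong (_* y w) (Lx w)) (ℚP.*-comm _ (y w))) ⟩
  Σᵥ n (λ w → y w * ([ w == u ] - [ w == v ]))   ≡⟨ Σᵥ-dipole n y u v ⟩
  y u - y v                                      ≡⟨ sym r′≡ ⟩
  r′                                             ∎
  where open ≡-Reasoning

onLevels : ∀ {n} → (ℕ → Bool → ℚ) → V n → ℚ
onLevels f w = f (toℕ (proj₁ w)) (proj₂ w)

pair : (ℕ → Bool → ℚ) → ℕ → ℚ
pair f m = f m false + f m true

adjacency-split : ∀ l m q → [ ((l ≡ᵇ m) ∧ q) ∨ (suc l ≡ᵇ m) ∨ (suc m ≡ᵇ l) ]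
   ≡ [ m ≡ᵇ l ] * [ q ] + [ m ≡ᵇ suc l ] + [ suc m ≡ᵇ l ]
adjacency-split zero          zero          true  = refl
adjacency-split zero          zero          false = refl
adjacency-split zero          (suc zero)    true  = refl
adjacency-split zero          (suc zero)    false = refl
adjacency-split zero          (suc (suc m)) true  = refl
adjacency-split zero          (suc (suc m)) false = refl
adjacency-split (suc zero)    zero          true  = refl
adjacency-split (suc zero)    zero          false = refl
adjacency-split (suc (suc l)) zero          true  = refl
adjacency-split (suc (suc l)) zero          false = refl
adjacency-split (suc l)       (suc m)       q     = adjacency-split l m q

differs-false : ∀ b → not (if b then false else true) ≡ b
differs-false true  = refl
differs-false false = refl

differs-true : ∀ b → not (if b then true else false) ≡ not b
differs-true true  = refl
differs-true false = refl

Σ-neighbours : ∀ n (i : Fin (suc n)) b (g : ℕ → Bool → ℚ) →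
  Σᵥ n (λ y → [ adj (i , b) y ] * onLevels g y)
  ≡ g (toℕ i) (not b) + [ toℕ i <ᵇ n ] * pair g (suc (toℕ i)) + [ 0 <ᵇ toℕ i ] * pair g (toℕ i ∸ 1)
Σ-neighbours n i b g = begin
  Σᵥ n (λ y → [ adj (i , b) y ] * onLevels g y)
    ≡⟨ Σᵥ-levels n (λ y → [ adj (i , b) y ] * onLevels g y) ⟩
  ∑ℕ (suc n) (λ m → [ A m false ] * g m false + [ A m true ] * g m true)
    ≡⟨ sum-cong-≗ {suc n} (λ j → by-case (toℕ j)) ⟩
  ∑ℕ (suc n) (λ m → T₁ m + T₂ m + T₃ m)
    ≡⟨ trans (∑ℕ-+ (suc n) (λ m → T₁ m + T₂ m) T₃) (cong (_+ ∑ℕ (suc n) T₃) (∑ℕ-+ (suc n) T₁ T₂)) ⟩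
  ∑ℕ (suc n) T₁ + ∑ℕ (suc n) T₂ + ∑ℕ (suc n) T₃
    ≡⟨ cong₂ _+_ (cong₂ _+_ twin-term (∑ℕ-delta (suc n) (suc l) (pair g)))
                 (∑ℕ-delta-pred (suc n) l (pair g) (ℕP.<⇒≤ (toℕ<n i))) ⟩
  g l (not b) + [ l <ᵇ n ] * pair g (suc l) + [ 0 <ᵇ l ] * pair g (l ∸ 1)
    ∎
  where
  open ≡-Reasoning
  l = toℕ i
  A : ℕ → Bool → Bool
  A m c = ((l ≡ᵇ m) ∧ not (if b then c else not c)) ∨ (suc l ≡ᵇ m) ∨ (suc m ≡ᵇ l)
  twin : ℕ → ℚ
  twin m = [ b ] * g m false + [ not b ] * g m true
  T₁ T₂ T₃ : ℕ → ℚ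
  T₁ m = [ m ≡ᵇ l ] * twin m
  T₂ m = [ m ≡ᵇ suc l ] * pair g m
  T₃ m = [ suc m ≡ᵇ l ] * pair g m
  by-case : ∀ m → [ A m false ] * g m false + [ A m true ] * g m true ≡ T₁ m + T₂ m + T₃ m
  by-case m rewrite adjacency-split l m (not (if b then false else true))
                  | adjacency-split l m (not (if b then true else false)) | differs-false b | differs-true b =
    solve 7 (λ e p q u d x y → (e :* p :+ u :+ d) :* x :+ (e :* q :+ u :+ d) :* y
                               := e :* (p :* x :+ q :* y) :+ u :* (x :+ y) :+ d :* (x :+ y))
      refl [ m ≡ᵇ l ] [ b ] [ not b ] [ m ≡ᵇ suc l ] [ suc m ≡ᵇ l ] (g m false) (g m true)
  twin-term : ∑ℕ (suc n) T₁ ≡ g l (not b)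
  twin-term = trans (∑ℕ-delta (suc n) l twin) (trans (cong (_* twin l) ([<ᵇ]≡1 (toℕ<n i))) (trans (ℚP.*-identityˡ (twin l)) (pick b)))
    where
    pick : ∀ b → [ b ] * g l false + [ not b ] * g l true ≡ g l (not b)
    pick true  = solve 2 (λ x y → con 1ℚ :* x :+ con 0ℚ :* y := x) refl (g l false) (g l true)
    pick false = solve 2 (λ x y → con 0ℚ :* x :+ con 1ℚ :* y := y) refl (g l false) (g l true)

laplacian-onLevels : ∀ n (f : ℕ → Bool → ℚ) (i : Fin (suc n)) b →
  laplacian (onLevels f) (i , b)
  ≡ (f (toℕ i) b - f (toℕ i) (not b))
    + [ toℕ i <ᵇ n ] * ((f (toℕ i) b - f (suc (toℕ i)) false) + (f (toℕ i) b - f (suc (toℕ i)) true))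
    + [ 0 <ᵇ toℕ i ] * ((f (toℕ i) b - f (toℕ i ∸ 1) false) + (f (toℕ i) b - f (toℕ i ∸ 1) true))
laplacian-onLevels n f i b = Σ-neighbours n i b (λ m c → f (toℕ i) b - f m c)

levelDeg : Bool → Bool → ℚ
levelDeg below above = 1ℚ + [ above ] * two + [ below ] * two

degAt : ℕ → ℕ → ℚ
degAt n l = levelDeg (0 <ᵇ l) (l <ᵇ n)

deg-level : ∀ n (i : Fin (suc n)) b → deg (i , b) ≡ degAt n (toℕ i)
deg-level n i b = trans (sumOver-cong (vertices n) (λ w → sym (ℚP.*-identityʳ [ adj (i , b) w ])))
                        (Σ-neighbours n i b (λ _ _ → 1ℚ))

-- 1 / (levelDeg + 1): the potential gap between the twins of the source level
twinGap : Bool → Bool → ℚ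
twinGap true  true  = ⅙
twinGap true  false = ¼
twinGap false true  = ¼
twinGap false false = ½

twinGap-inverse : ∀ below above → twinGap below above * (levelDeg below above + 1ℚ) ≡ 1ℚ
twinGap-inverse true  true  = refl
twinGap-inverse true  false = refl
twinGap-inverse false true  = refl
twinGap-inverse false false = refl

gapAt : ℕ → ℕ → ℚ
gapAt n k = twinGap (0 <ᵇ k) (k <ᵇ n)

side : Bool → Bool → ℚ
side true  true  = 1ℚ
side true  false = - 1ℚ
side false true  = - 1ℚ
side false false = 1ℚ

side-not : ∀ b c → side b (not c) ≡ - side b c
side-not true  true  = refl
side-not true  false = refl
side-not false true  = refl
side-not false false = refl

side-indicator : ∀ b d → ½ * side b d + ½ ≡ [ if d then b else not b ]
side-indicator true  true  = refl
side-indicator true  false = refl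
side-indicator false true  = refl
side-indicator false false = refl

-- Potential of unit current entering at (k, b) and leaving in equal halves through the two
-- vertices of level 0. It is the sum of
--  * a level drop, falling by ¼ per level below k (four unit resistors join consecutive levels);
--  * a twin split ±½ gapAt n k on level k itself, carrying the current to the side b.
levelDrop : ℕ → ℕ → ℚ
levelDrop k m = - (¼ * toℚ (k ∸ m))

twinSplit : ℕ → ℕ → Bool → ℕ → Bool → ℚ
twinSplit n k b m c = [ m ≡ᵇ k ] * (½ * gapAt n k * side b c)

potential : ℕ → ℕ → Bool → ℕ → Bool → ℚ
potential n k b m c = twinSplit n k b m c + levelDrop k m

laplacian-twinSplit : ∀ n k (s : Bool → ℚ) → (∀ c → s (not c) ≡ - s c) → (i : Fin (suc n)) (d : Bool) →
  laplacian (onLevels (λ m c → [ m ≡ᵇ k ] * s c)) (i , d)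
  ≡ [ toℕ i ≡ᵇ k ] * ((degAt n (toℕ i) + 1ℚ) * s d)
laplacian-twinSplit n k s s-anti i d =
  trans (laplacian-onLevels n (λ m c → [ m ≡ᵇ k ] * s c) i d) (begin
    (E * s d - E * s (not d)) + A * ((E * s d - E₁ * s false) + (E * s d - E₁ * s true))
      + Z * ((E * s d - E₂ * s false) + (E * s d - E₂ * s true))
      ≡⟨ cong₂ (λ x y → (E * s d - E * x) + A * ((E * s d - E₁ * s false) + (E * s d - E₁ * y))
                          + Z * ((E * s d - E₂ * s false) + (E * s d - E₂ * y)))
               (s-anti d) (s-anti false) ⟩
    (E * s d - E * - s d) + A * ((E * s d - E₁ * s false) + (E * s d - E₁ * - s false))
      + Z * ((E * s d - E₂ * s false) + (E * s d - E₂ * - s false))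
      ≡⟨ solve 7 (λ E E₁ E₂ A Z x y →
           (E :* x :- E :* :- x) :+ A :* ((E :* x :- E₁ :* y) :+ (E :* x :- E₁ :* :- y))
             :+ Z :* ((E :* x :- E₂ :* y) :+ (E :* x :- E₂ :* :- y))
           := E :* ((con 1ℚ :+ A :* con two :+ Z :* con two :+ con 1ℚ) :* x))
           refl E E₁ E₂ A Z (s d) (s false) ⟩
    E * ((degAt n l + 1ℚ) * s d) ∎)
  where
  open ≡-Reasoning
  l  = toℕ i
  E  = [ l ≡ᵇ k ]
  E₁ = [ suc l ≡ᵇ k ]
  E₂ = [ l ∸ 1 ≡ᵇ k ]
  A  = [ l <ᵇ n ]
  Z  = [ 0 <ᵇ l ]

levelDrop-step : ∀ k l → levelDrop k l - levelDrop k (suc l) ≡ - (¼ * [ l <ᵇ k ])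
levelDrop-step k l = trans
  (solve 2 (λ a b → :- (con ¼ :* a) :- :- (con ¼ :* b) := :- (con ¼ :* (a :- b))) refl (toℚ (k ∸ l)) (toℚ (k ∸ suc l)))
  (cong (λ x → - (¼ * x)) (toℚ-∸-step k l))

levelDrop-step-down : ∀ k l → [ 0 <ᵇ l ] * (levelDrop k l - levelDrop k (l ∸ 1)) ≡ [ 0 <ᵇ l ] * (¼ * [ l ∸ 1 <ᵇ k ])
levelDrop-step-down k zero    = trans (ℚP.*-zeroˡ (levelDrop k 0 - levelDrop k 0)) (sym (ℚP.*-zeroˡ (¼ * [ 0 <ᵇ k ])))
levelDrop-step-down k (suc l) = cong (1ℚ *_) (begin
  levelDrop k (suc l) - levelDrop k l      ≡⟨ solve 2 (λ a b → b :- a := :- (a :- b)) refl (levelDrop k l) (levelDrop k (suc l)) ⟩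
  - (levelDrop k l - levelDrop k (suc l))  ≡⟨ cong -_ (levelDrop-step k l) ⟩
  - - (¼ * [ l <ᵇ k ])                     ≡⟨ solve 1 (λ x → :- :- x := x) refl (¼ * [ l <ᵇ k ]) ⟩
  ¼ * [ l <ᵇ k ]                           ∎)
  where open ≡-Reasoning

-- Kirchhoff balance of the level drop: current ½ arrives from below at every level 0 < l ≤ k
-- and leaves upwards at every level l < k.
level-balance : ∀ l k → [ 0 <ᵇ l ] * [ l ∸ 1 <ᵇ k ] - [ l <ᵇ k ] ≡ [ l ≡ᵇ k ] - [ l ≡ᵇ 0 ]
level-balance zero    zero    = refl
level-balance zero    (suc k) = refl
level-balance (suc l) zero    = refl
level-balance (suc l) (suc k) rewrite [<ᵇ]-suc l k =
  solve 2 (λ e u → con 1ℚ :* (e :+ u) :- u := e :- con 0ℚ) refl [ l ≡ᵇ k ] [ l <ᵇ k ]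

laplacian-levelDrop : ∀ n k → k ℕ.≤ n → (i : Fin (suc n)) (d : Bool) →
  laplacian (onLevels (λ m _ → levelDrop k m)) (i , d) ≡ ½ * [ toℕ i ≡ᵇ k ] - ½ * [ toℕ i ≡ᵇ 0 ]
laplacian-levelDrop n k k≤n i d =
  trans (laplacian-onLevels n (λ m _ → levelDrop k m) i d) (begin
    (h l - h l) + A * ((h l - h (suc l)) + (h l - h (suc l))) + Z * ((h l - h (l ∸ 1)) + (h l - h (l ∸ 1)))
      ≡⟨ solve 5 (λ x y z A Z → (x :- x) :+ A :* ((x :- y) :+ (x :- y)) :+ Z :* ((x :- z) :+ (x :- z))
                                := con two :* (A :* (x :- y)) :+ con two :* (Z :* (x :- z)))
           refl (h l) (h (suc l)) (h (l ∸ 1)) A Z ⟩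
    two * (A * (h l - h (suc l))) + two * (Z * (h l - h (l ∸ 1)))
      ≡⟨ cong₂ (λ x y → two * (A * x) + two * y) (levelDrop-step k l) (levelDrop-step-down k l) ⟩
    two * (A * - (¼ * [ l <ᵇ k ])) + two * (Z * (¼ * [ l ∸ 1 <ᵇ k ]))
      ≡⟨ solve 4 (λ A u Z v → con two :* (A :* :- (con ¼ :* u)) :+ con two :* (Z :* (con ¼ :* v))
                              := con ½ :* (Z :* v :- A :* u)) refl A [ l <ᵇ k ] Z [ l ∸ 1 <ᵇ k ] ⟩
    ½ * (Z * [ l ∸ 1 <ᵇ k ] - A * [ l <ᵇ k ])
      ≡⟨ cong (λ x → ½ * (Z * [ l ∸ 1 <ᵇ k ] - x)) ([<ᵇ]-mono l k n k≤n) ⟩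
    ½ * (Z * [ l ∸ 1 <ᵇ k ] - [ l <ᵇ k ])
      ≡⟨ cong (½ *_) (level-balance l k) ⟩
    ½ * ([ l ≡ᵇ k ] - [ l ≡ᵇ 0 ])
      ≡⟨ solve 2 (λ e z → con ½ :* (e :- z) := con ½ :* e :- con ½ :* z) refl [ l ≡ᵇ k ] [ l ≡ᵇ 0 ] ⟩
    ½ * [ l ≡ᵇ k ] - ½ * [ l ≡ᵇ 0 ] ∎)
  where
  open ≡-Reasoning
  l = toℕ i
  h = levelDrop k
  A = [ l <ᵇ n ]
  Z = [ 0 <ᵇ l ]

twinSplit-source : ∀ n l k x → [ l ≡ᵇ k ] * ((degAt n l + 1ℚ) * (½ * gapAt n k * x)) ≡ [ l ≡ᵇ k ] * (½ * x)
twinSplit-source n l k x with l ≡ᵇ k in l≡ᵇk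
... | false = trans (ℚP.*-zeroˡ ((degAt n l + 1ℚ) * (½ * gapAt n k * x))) (sym (ℚP.*-zeroˡ (½ * x)))
... | true rewrite ℕP.≡ᵇ⇒≡ l k (subst T (sym l≡ᵇk) _) = cong (1ℚ *_) (begin
  (degAt n k + 1ℚ) * (½ * gapAt n k * x)       ≡⟨ solve 4 (λ d g h x → d :* (h :* g :* x) := h :* (g :* d) :* x) refl (degAt n k + 1ℚ) (gapAt n k) ½ x ⟩
  ½ * (gapAt n k * (degAt n k + 1ℚ)) * x       ≡⟨ cong (λ t → ½ * t * x) (twinGap-inverse (0 <ᵇ k) (k <ᵇ n)) ⟩
  ½ * 1ℚ * x                                   ≡⟨ cong (_* x) (ℚP.*-identityʳ ½) ⟩
  ½ * x                                        ∎)
  where open ≡-Reasoning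

laplacian-potential : ∀ n k b → k ℕ.≤ n → (i : Fin (suc n)) (d : Bool) →
  laplacian (onLevels (potential n k b)) (i , d)
  ≡ [ (toℕ i ≡ᵇ k) ∧ (if d then b else not b) ] - ½ * [ toℕ i ≡ᵇ 0 ]
laplacian-potential n k b k≤n i d = begin
  laplacian (onLevels (potential n k b)) (i , d)
    ≡⟨ laplacianOn-+ (vertices n) (λ w y → [ adj w y ]) (onLevels (twinSplit n k b)) (onLevels (λ m _ → levelDrop k m)) (i , d) ⟩
  laplacian (onLevels (twinSplit n k b)) (i , d) + laplacian (onLevels (λ m _ → levelDrop k m)) (i , d)
    ≡⟨ cong₂ _+_ (laplacian-twinSplit n k s s-anti i d) (laplacian-levelDrop n k k≤n i d) ⟩
  [ l ≡ᵇ k ] * ((degAt n l + 1ℚ) * s d) + (½ * [ l ≡ᵇ k ] - ½ * [ l ≡ᵇ 0 ])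
    ≡⟨ cong (_+ (½ * [ l ≡ᵇ k ] - ½ * [ l ≡ᵇ 0 ])) (twinSplit-source n l k (side b d)) ⟩
  [ l ≡ᵇ k ] * (½ * side b d) + (½ * [ l ≡ᵇ k ] - ½ * [ l ≡ᵇ 0 ])
    ≡⟨ solve 3 (λ e σ z → e :* (con ½ :* σ) :+ (con ½ :* e :- con ½ :* z) := e :* (con ½ :* σ :+ con ½) :- con ½ :* z)
         refl [ l ≡ᵇ k ] (side b d) [ l ≡ᵇ 0 ] ⟩
  [ l ≡ᵇ k ] * (½ * side b d + ½) - ½ * [ l ≡ᵇ 0 ]
    ≡⟨ cong (λ t → [ l ≡ᵇ k ] * t - ½ * [ l ≡ᵇ 0 ]) (side-indicator b d) ⟩
  [ l ≡ᵇ k ] * [ if d then b else not b ] - ½ * [ l ≡ᵇ 0 ]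
    ≡⟨ cong (_- ½ * [ l ≡ᵇ 0 ]) (sym ([∧] (l ≡ᵇ k) _)) ⟩
  [ (l ≡ᵇ k) ∧ (if d then b else not b) ] - ½ * [ l ≡ᵇ 0 ] ∎
  where
  open ≡-Reasoning
  l = toℕ i
  s : Bool → ℚ
  s c = ½ * gapAt n k * side b c
  s-anti : ∀ c → s (not c) ≡ - s c
  s-anti c = trans (cong (½ * gapAt n k *_) (side-not b c)) (sym (ℚP.neg-distribʳ-* (½ * gapAt n k) (side b c)))

potentialAt : ∀ n → V n → V n → ℚ
potentialAt n u = onLevels (potential n (toℕ (proj₁ u)) (proj₂ u))

laplacian-potentialAt : ∀ n u w → laplacian (potentialAt n u) w ≡ [ w == u ] - ½ * [ toℕ (proj₁ w) ≡ᵇ 0 ]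
laplacian-potentialAt n (j , b) (i , d) = laplacian-potential n (toℕ j) b (toℕ≤pred[n] j) i d

-- Subtracting the potentials of u and v cancels the drain at level 0: unit current from u to v.
dipole : ∀ n → V n → V n → V n → ℚ
dipole n u v w = potentialAt n u w - potentialAt n v w

laplacian-dipole : ∀ n u v w → laplacian (dipole n u v) w ≡ [ w == u ] - [ w == v ]
laplacian-dipole n u v w = begin
  laplacian (dipole n u v) w
    ≡⟨ laplacianOn-- (vertices n) (λ w y → [ adj w y ]) (potentialAt n u) (potentialAt n v) w ⟩
  laplacian (potentialAt n u) w - laplacian (potentialAt n v) w
    ≡⟨ cong₂ _-_ (laplacian-potentialAt n u w) (laplacian-potentialAt n v w) ⟩
  ([ w == u ] - ½ * z) - ([ w == v ] - ½ * z)
    ≡⟨ solve 3 (λ a b z → (a :- z) :- (b :- z) := a :- b) refl [ w == u ] [ w == v ] (½ * z) ⟩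
  [ w == u ] - [ w == v ] ∎
  where
  open ≡-Reasoning
  z = [ toℕ (proj₁ w) ≡ᵇ 0 ]

resistance : ∀ n → V n → V n → ℚ
resistance n u v = dipole n u v u - dipole n u v v

resistance-isResistance : ∀ n → IsResistance n (resistance n)
resistance-isResistance n u v = dipole n u v , laplacian-dipole n u v , refl

resistanceOnLevels : ℕ → ℕ → Bool → ℕ → Bool → ℚ
resistanceOnLevels n k b l c =
  (potential n k b k b - potential n l c k b) - (potential n k b l c - potential n l c l c)

-- Summed over the four choices of sides, the resistance between levels k and l is
-- 2 gap_k + 2 gap_l + |k - l|: the twin splits cancel and the level drops add up.
levelResistance : ℕ → ℕ → ℕ → ℚ
levelResistance n k l = two * gapAt n k + two * gapAt n l + (toℚ (k ∸ l) + toℚ (l ∸ k))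

resistance-sides : ∀ n k l →
  (resistanceOnLevels n k false l false + resistanceOnLevels n k false l true)
  + (resistanceOnLevels n k true l false + resistanceOnLevels n k true l true)
  ≡ levelResistance n k l
resistance-sides n k l rewrite ≡ᵇ-refl k | ≡ᵇ-refl l | ℕP.n∸n≡0 k | ℕP.n∸n≡0 l =
  solve 6 (λ gk gl e e′ a a′ →
    let P g e σ x = e :* (con ½ :* g :* con σ) :+ :- (con ¼ :* x)
        R b c = (P gk (con 1ℚ) (side b b) (con 0ℚ) :- P gl e′ (side c b) a′)
                :- (P gk e (side b c) a :- P gl (con 1ℚ) (side c c) (con 0ℚ))
    in (R false false :+ R false true) :+ (R true false :+ R true true)
       := con two :* gk :+ con two :* gl :+ (a :+ a′))
    refl (gapAt n k) (gapAt n l) [ l ≡ᵇ k ] [ k ≡ᵇ l ] (toℚ (k ∸ l)) (toℚ (l ∸ k))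

-- Kf* as a double sum over levels: degrees depend only on the level, so the four pairs of
-- sides of two levels can be summed first.
kirchhoff-levels : ∀ n → KfStar n (resistance n)
  ≡ ½ * ∑ℕ (suc n) (λ k → ∑ℕ (suc n) (λ l → degAt n k * degAt n l * levelResistance n k l))
kirchhoff-levels n = cong (½ *_) (begin
  Σᵥ n (λ u → Σᵥ n (λ v → deg u * deg v * resistance n u v))
    ≡⟨ sumOver-cong (vertices n) (λ u → sumOver-cong (vertices n) (λ v →
         cong₂ (λ x y → x * y * resistance n u v) (deg-level n (proj₁ u) (proj₂ u)) (deg-level n (proj₁ v) (proj₂ v)))) ⟩
  Σᵥ n (λ u → Σᵥ n (λ v → D (lev u) * D (lev v) * R (lev u) (proj₂ u) (lev v) (proj₂ v)))
    ≡⟨ sumOver-cong (vertices n) (λ u → Σᵥ-levels n (λ v → D (lev u) * D (lev v) * R (lev u) (proj₂ u) (lev v) (proj₂ v))) ⟩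
  Σᵥ n (λ u → ∑ℕ (suc n) (λ l → F (lev u) (proj₂ u) l false + F (lev u) (proj₂ u) l true))
    ≡⟨ Σᵥ-levels n (λ u → ∑ℕ (suc n) (λ l → F (lev u) (proj₂ u) l false + F (lev u) (proj₂ u) l true)) ⟩
  ∑ℕ (suc n) (λ k → ∑ℕ (suc n) (λ l → F k false l false + F k false l true)
                  + ∑ℕ (suc n) (λ l → F k true l false + F k true l true))
    ≡⟨ sum-cong-≗ {suc n} (λ i → sym (∑ℕ-+ (suc n) (λ l → F (toℕ i) false l false + F (toℕ i) false l true)
                                                   (λ l → F (toℕ i) true l false + F (toℕ i) true l true))) ⟩
  ∑ℕ (suc n) (λ k → ∑ℕ (suc n) (λ l → (F k false l false + F k false l true) + (F k true l false + F k true l true)))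
    ≡⟨ sum-cong-≗ {suc n} (λ i → sum-cong-≗ {suc n} (λ j → four-sides (toℕ i) (toℕ j))) ⟩
  ∑ℕ (suc n) (λ k → ∑ℕ (suc n) (λ l → D k * D l * levelResistance n k l)) ∎)
  where
  open ≡-Reasoning
  D = degAt n
  R = resistanceOnLevels n
  lev : V n → ℕ
  lev w = toℕ (proj₁ w)
  F : ℕ → Bool → ℕ → Bool → ℚ
  F k b l c = D k * D l * R k b l c
  four-sides : ∀ k l → (F k false l false + F k false l true) + (F k true l false + F k true l true)
                     ≡ D k * D l * levelResistance n k l
  four-sides k l = trans
    (solve 5 (λ d r₁ r₂ r₃ r₄ → (d :* r₁ :+ d :* r₂) :+ (d :* r₃ :+ d :* r₄) := d :* ((r₁ :+ r₂) :+ (r₃ :+ r₄)))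
       refl (D k * D l) (R k false l false) (R k false l true) (R k true l false) (R k true l true))
    (cong (D k * D l *_) (resistance-sides n k l))

totalDeg weightedGap distanceMoment : ℕ → ℚ
totalDeg n       = ∑ℕ (suc n) (degAt n)
weightedGap n    = ∑ℕ (suc n) (λ k → degAt n k * gapAt n k)
distanceMoment n = ∑ℕ (suc n) (λ k → ∑ℕ (suc n) (λ l → degAt n k * degAt n l * toℚ (k ∸ l)))

-- The twin-gap part of the resistances contributes 2 (Σ d_k gap_k)(Σ d_l), the level part
-- Σ_k Σ_l d_k d_l (k ∸ l).
kirchhoff-moments : ∀ n → KfStar n (resistance n) ≡ two * (weightedGap n * totalDeg n) + distanceMoment n
kirchhoff-moments n = begin
  KfStar n (resistance n)
    ≡⟨ kirchhoff-levels n ⟩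
  ½ * ∑ℕ N (λ k → ∑ℕ N (λ l → D k * D l * levelResistance n k l))
    ≡⟨ cong (½ *_) (sum-cong-≗ {N} (λ i → sum-cong-≗ {N} (λ j → symmetric-parts (toℕ i) (toℕ j)))) ⟩
  ½ * ∑ℕ N (λ k → ∑ℕ N (λ l → G k l + G l k))
    ≡⟨ cong (½ *_) (∑∑-symmetrise N G) ⟩
  ½ * (two * ∑ℕ N (λ k → ∑ℕ N (λ l → (two * a k) * D l + X k l)))
    ≡⟨ cong (λ t → ½ * (two * t)) (trans (sum-cong-≗ {N} (λ i → ∑ℕ-+ N (λ l → (two * a (toℕ i)) * D l) (X (toℕ i))))
                                         (∑ℕ-+ N (λ k → ∑ℕ N (λ l → (two * a k) * D l)) (λ k → ∑ℕ N (X k)))) ⟩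
  ½ * (two * (∑ℕ N (λ k → ∑ℕ N (λ l → (two * a k) * D l)) + distanceMoment n))
    ≡⟨ cong (λ t → ½ * (two * (t + distanceMoment n))) (trans (∑∑-product N (λ k → two * a k) D)
                                                              (cong (_* totalDeg n) (∑ℕ-*ˡ N two a))) ⟩
  ½ * (two * (two * weightedGap n * totalDeg n + distanceMoment n))
    ≡⟨ solve 3 (λ A T Q → con ½ :* (con two :* (con two :* A :* T :+ Q)) := con two :* (A :* T) :+ Q)
         refl (weightedGap n) (totalDeg n) (distanceMoment n) ⟩
  two * (weightedGap n * totalDeg n) + distanceMoment n ∎
  where
  open ≡-Reasoning
  N = suc n
  D = degAt n
  a : ℕ → ℚ
  a k = D k * gapAt n k
  X : ℕ → ℕ → ℚ
  X k l = D k * D l * toℚ (k ∸ l)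
  G : ℕ → ℕ → ℚ
  G k l = (two * a k) * D l + X k l
  symmetric-parts : ∀ k l → D k * D l * levelResistance n k l ≡ G k l + G l k
  symmetric-parts k l = solve 6 (λ dk dl gk gl x y →
      dk :* dl :* (con two :* gk :+ con two :* gl :+ (x :+ y))
      := ((con two :* (dk :* gk)) :* dl :+ dk :* dl :* x) :+ ((con two :* (dl :* gl)) :* dk :+ dl :* dk :* y))
    refl (D k) (D l) (gapAt n k) (gapAt n l) (toℚ (k ∸ l)) (toℚ (l ∸ k))

∑-levels : ∀ m (F : Bool → Bool → ℕ → ℚ) →
  ∑ℕ (suc (suc m)) (λ k → F (0 <ᵇ k) (k <ᵇ suc m) k)
  ≡ F false true 0 + ∑ℕ m (λ j → F true true (suc j)) + F true false (suc m)
∑-levels m F = begin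
  h 0 + ∑ℕ (suc m) (λ j → h (suc j))
    ≡⟨ cong (_+_ (h 0)) (∑ℕ-snoc m (λ j → h (suc j))) ⟩
  h 0 + (∑ℕ m (λ j → h (suc j)) + h (suc m))
    ≡⟨ sym (ℚP.+-assoc (h 0) _ _) ⟩
  h 0 + ∑ℕ m (λ j → h (suc j)) + h (suc m)
    ≡⟨ cong₂ (λ x y → h 0 + x + y) (∑ℕ-congBelow m (λ j j<m → cong (λ a → F true a (suc j)) (<ᵇ-true j<m)))
                                   (cong (λ a → F true a (suc m)) (<ᵇ-irrefl m)) ⟩
  F false true 0 + ∑ℕ m (λ j → F true true (suc j)) + F true false (suc m) ∎
  where
  open ≡-Reasoning
  h : ℕ → ℚ
  h k = F (0 <ᵇ k) (k <ᵇ suc m) k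

d₀ dᵢ d₁ : ℚ
d₀ = levelDeg false true
dᵢ = levelDeg true true
d₁ = levelDeg true false

totalDeg-closed : ∀ m → totalDeg (suc m) ≡ d₀ + toℚ m * dᵢ + d₁
totalDeg-closed m = trans (∑-levels m (λ b a _ → levelDeg b a)) (cong (λ x → d₀ + x + d₁) (∑ℕ-const m dᵢ))

weightedGap-closed : ∀ m → weightedGap (suc m)
  ≡ d₀ * twinGap false true + toℚ m * (dᵢ * twinGap true true) + d₁ * twinGap true false
weightedGap-closed m = trans (∑-levels m (λ b a _ → levelDeg b a * twinGap b a))
  (cong (λ x → d₀ * twinGap false true + x + d₁ * twinGap true false) (∑ℕ-const m (dᵢ * twinGap true true)))

row : ℕ → ℕ → ℚ
row n k = ∑ℕ (suc n) (λ l → degAt n l * toℚ (k ∸ l))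

distanceMoment-rows : ∀ n → distanceMoment n ≡ ∑ℕ (suc n) (λ k → degAt n k * row n k)
distanceMoment-rows n = sum-cong-≗ {suc n} (λ i → trans
  (sum-cong-≗ {suc n} (λ j → ℚP.*-assoc (degAt n (toℕ i)) (degAt n (toℕ j)) (toℚ (toℕ i ∸ toℕ j))))
  (∑ℕ-*ˡ (suc n) (degAt n (toℕ i)) (λ l → degAt n l * toℚ (toℕ i ∸ l))))

row-bottom : ∀ m → row (suc m) 0 ≡ 0ℚ
row-bottom m = trans (sum-cong-≗ {suc (suc m)} (λ j →
    trans (cong (λ x → degAt (suc m) (toℕ j) * toℚ x) (ℕP.0∸n≡0 (toℕ j))) (ℚP.*-zeroʳ (degAt (suc m) (toℕ j)))))
  (sum-replicate-zero (suc (suc m)))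

row-above : ∀ m i → i ℕ.≤ m → row (suc m) (suc i) ≡ d₀ * toℚ (suc i) + dᵢ * ∑ℕ m (λ j → toℚ (i ∸ j))
row-above m i i≤m = begin
  row (suc m) (suc i)
    ≡⟨ ∑-levels m (λ b a l → levelDeg b a * toℚ (suc i ∸ l)) ⟩
  d₀ * toℚ (suc i) + ∑ℕ m (λ j → dᵢ * toℚ (i ∸ j)) + d₁ * toℚ (i ∸ m)
    ≡⟨ cong₂ (λ x y → d₀ * toℚ (suc i) + x + d₁ * toℚ y) (∑ℕ-*ˡ m dᵢ (λ j → toℚ (i ∸ j))) (ℕP.m≤n⇒m∸n≡0 i≤m) ⟩
  d₀ * toℚ (suc i) + dᵢ * ∑ℕ m (λ j → toℚ (i ∸ j)) + d₁ * 0ℚ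
    ≡⟨ solve 2 (λ x y → x :+ y :+ con d₁ :* con 0ℚ := x :+ y) refl (d₀ * toℚ (suc i)) (dᵢ * ∑ℕ m (λ j → toℚ (i ∸ j))) ⟩
  d₀ * toℚ (suc i) + dᵢ * ∑ℕ m (λ j → toℚ (i ∸ j)) ∎
  where open ≡-Reasoning

distanceMoment-closed : ∀ m → distanceMoment (suc m)
  ≡ dᵢ * (d₀ * triangle m + dᵢ * tetrahedron m) + d₁ * (d₀ * toℚ (suc m) + dᵢ * triangle m)
distanceMoment-closed m = begin
  distanceMoment (suc m)
    ≡⟨ distanceMoment-rows (suc m) ⟩
  ∑ℕ (suc (suc m)) (λ k → degAt (suc m) k * r k)
    ≡⟨ ∑-levels m (λ b a k → levelDeg b a * r k) ⟩
  d₀ * r 0 + ∑ℕ m (λ i → dᵢ * r (suc i)) + d₁ * r (suc m)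
    ≡⟨ cong₂ _+_ (cong₂ (λ x y → d₀ * x + y) (row-bottom m) interior) (cong (d₁ *_) (row-above m m ℕP.≤-refl)) ⟩
  d₀ * 0ℚ + dᵢ * (d₀ * triangle m + dᵢ * tetrahedron m) + d₁ * (d₀ * toℚ (suc m) + dᵢ * ∑ℕ m (λ j → toℚ (m ∸ j)))
    ≡⟨ cong (λ x → d₀ * 0ℚ + dᵢ * (d₀ * triangle m + dᵢ * tetrahedron m) + d₁ * (d₀ * toℚ (suc m) + dᵢ * x)) (∑-descending m) ⟩
  d₀ * 0ℚ + dᵢ * (d₀ * triangle m + dᵢ * tetrahedron m) + d₁ * (d₀ * toℚ (suc m) + dᵢ * triangle m)
    ≡⟨ solve 2 (λ x y → con d₀ :* con 0ℚ :+ x :+ y := x :+ y) refl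
         (dᵢ * (d₀ * triangle m + dᵢ * tetrahedron m)) (d₁ * (d₀ * toℚ (suc m) + dᵢ * triangle m)) ⟩
  dᵢ * (d₀ * triangle m + dᵢ * tetrahedron m) + d₁ * (d₀ * toℚ (suc m) + dᵢ * triangle m) ∎
  where
  open ≡-Reasoning
  r = row (suc m)
  interior : ∑ℕ m (λ i → dᵢ * r (suc i)) ≡ dᵢ * (d₀ * triangle m + dᵢ * tetrahedron m)
  interior = begin
    ∑ℕ m (λ i → dᵢ * r (suc i))
      ≡⟨ ∑ℕ-*ˡ m dᵢ (λ i → r (suc i)) ⟩
    dᵢ * ∑ℕ m (λ i → r (suc i))
      ≡⟨ cong (dᵢ *_) (∑ℕ-congBelow m (λ i i<m → row-above m i (ℕP.<⇒≤ i<m))) ⟩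
    dᵢ * ∑ℕ m (λ i → d₀ * toℚ (suc i) + dᵢ * ∑ℕ m (λ j → toℚ (i ∸ j)))
      ≡⟨ cong (dᵢ *_) (trans (∑ℕ-+ m (λ i → d₀ * toℚ (suc i)) (λ i → dᵢ * ∑ℕ m (λ j → toℚ (i ∸ j))))
                             (cong₂ _+_ (∑ℕ-*ˡ m d₀ (λ i → toℚ (suc i))) (∑ℕ-*ˡ m dᵢ (λ i → ∑ℕ m (λ j → toℚ (i ∸ j)))))) ⟩
    dᵢ * (d₀ * ∑ℕ m (λ i → toℚ (suc i)) + dᵢ * ∑ℕ m (λ i → ∑ℕ m (λ j → toℚ (i ∸ j))))
      ≡⟨ cong₂ (λ x y → dᵢ * (d₀ * x + dᵢ * y)) (∑-ascending m) (∑∑-monus m) ⟩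
    dᵢ * (d₀ * triangle m + dᵢ * tetrahedron m) ∎

kirchhoff-closed : ∀ m → KfStar (suc m) (resistance (suc m))
  ≡ (+ (25 ℕ.* suc m ^ 3 ℕ.+ 65 ℕ.* suc m ^ 2 ℕ.+ 64 ℕ.* suc m ℕ.+ 8)) / 6
kirchhoff-closed m = begin
  KfStar (suc m) (resistance (suc m))
    ≡⟨ kirchhoff-moments (suc m) ⟩
  two * (weightedGap (suc m) * totalDeg (suc m)) + distanceMoment (suc m)
    ≡⟨ cong₂ (λ a q → two * a + q) (cong₂ _*_ (weightedGap-closed m) (totalDeg-closed m)) (distanceMoment-closed m) ⟩
  two * ((d₀ * twinGap false true + x * (dᵢ * twinGap true true) + d₁ * twinGap true false) * (d₀ + x * dᵢ + d₁))
    + (dᵢ * (d₀ * triangle m + dᵢ * tetrahedron m) + d₁ * (d₀ * (1ℚ + x) + dᵢ * triangle m))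
    ≡⟨ solve 1 (λ x →
         let T = x :* (x :+ con 1ℚ) :* con ½
             P = (x :- con 1ℚ) :* x :* (x :+ con 1ℚ) :* con ⅙
             n = con 1ℚ :+ x
         in con two :* ((con (d₀ * twinGap false true) :+ x :* con (dᵢ * twinGap true true) :+ con (d₁ * twinGap true false))
                        :* (con d₀ :+ x :* con dᵢ :+ con d₁))
            :+ (con dᵢ :* (con d₀ :* T :+ con dᵢ :* P) :+ con d₁ :* (con d₀ :* n :+ con dᵢ :* T))
         := (con (toℚ 25) :* (n :* (n :* (n :* con 1ℚ))) :+ con (toℚ 65) :* (n :* (n :* con 1ℚ))
             :+ con (toℚ 64) :* n :+ con (toℚ 8)) :* con ⅙)
         refl x ⟩
  (toℚ 25 * (n * (n * (n * 1ℚ))) + toℚ 65 * (n * (n * 1ℚ)) + toℚ 64 * n + toℚ 8) * ⅙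
    ≡⟨ sym (trans (toℚ-/6 N) (cong (_* ⅙) (toℚ-polynomial (suc m)))) ⟩
  (+ N) / 6 ∎
  where
  open ≡-Reasoning
  x = toℚ m
  n = toℚ (suc m)
  N = 25 ℕ.* suc m ^ 3 ℕ.+ 65 ℕ.* suc m ^ 2 ℕ.+ 64 ℕ.* suc m ℕ.+ 8

KfStar-cong : ∀ n {R R′ : V n → V n → ℚ} → (∀ u v → R u v ≡ R′ u v) → KfStar n R ≡ KfStar n R′
KfStar-cong n R≗R′ = cong (½ *_) (sumOver-cong (vertices n) (λ u → sumOver-cong (vertices n) (λ v →
  cong (deg u * deg v *_) (R≗R′ u v))))

theorem3p5 : (n : ℕ) → n ≥ 1 →
    ∃ (λ R → IsResistance n R)
    × ((R : V n → V n → ℚ) → IsResistance n R →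
        KfStar n R ≡ (+ (25 ℕ.* n ^ 3 ℕ.+ 65 ℕ.* n ^ 2 ℕ.+ 64 ℕ.* n ℕ.+ 8)) / 6)
theorem3p5 (suc m) _ = (resistance (suc m) , resistance-isResistance (suc m)) , λ R R-isResistance → begin
  KfStar (suc m) R
    ≡⟨ KfStar-cong (suc m) (λ u v → resistance-unique (suc m) u v (R-isResistance u v) (resistance-isResistance (suc m) u v)) ⟩
  KfStar (suc m) (resistance (suc m))
    ≡⟨ kirchhoff-closed m ⟩
  (+ (25 ℕ.* suc m ^ 3 ℕ.+ 65 ℕ.* suc m ^ 2 ℕ.+ 64 ℕ.* suc m ℕ.+ 8)) / 6 ∎
  where open ≡-Reasoning
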